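{- For every nontrivial connected graph $G$, $\alpha_{bn}(G) < 2\alpha(G)$, where $\alpha(G)$ is the independence number of $G$.
   Context: A broadcast on a nontrivial connected graph $G$ is a function $f:V(G)\to\{0,1,\dots,\operatorname{diam}(G)\}$ with $f(v)\le e(v)$ (the eccentricity of $v$) for every $v$. Let $V_f^+=\{v: f(v)>0\}$ (broadcasting vertices). A vertex $u$ hears $f$ from $v\in V_f^+$ if $d_G(u,v)\le f(v)$; $N_f(v)$ is the set of vertices hearing $f$ from $v$ (including $v$), $PN_f(v)$ is the set of vertices hearing $f$ only from $v$, and $B_f(v)=\{u\in N_f(v): d_G(u,v)=f(v)\}$. The broadcast $f$ is boundary independent (bn-independent) if $N_f(v)\setminus B_f(v)\subseteq PN_f(v)$ for all $v\in V_f^+$. The cost of $f$ is $\sigma(f)=\sum_{v}f(v)$, and $\alpha_{bn}(G)$ is the maximum cost of a boundary independent broadcast on $G$. -}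

module Defs where

open import Data.Nat using (ℕ; zero; suc; _≤_; _<_; _*_)
open import Data.Fin using (Fin)
open import Data.Fin.Subset using (Subset; _∈_; ∣_∣)
open import Data.List using (tabulate)
open import Data.Nat.ListAction using (sum)
open import Data.Product using (Σ; _×_; ∃; ∃-syntax)
open import Relation.Nullary using (¬_; Dec)
open import Relation.Binary.PropositionalEquality using (_≡_)

record Graph (n : ℕ) : Set₁ where
  field
    Adj   : Fin n → Fin n → Set
    adj?  : ∀ u v → Dec (Adj u v)
    sym   : ∀ {u v} → Adj u v → Adj v u
    irrefl : ∀ {u} → ¬ Adj u u
open Graph public

module _ {n : ℕ} (G : Graph n) where

  data Walk : Fin n → Fin n → ℕ → Set where
    here  : ∀ {u} → Walk u u 0
    step  : ∀ {u w v k} → Adj G u w → Walk w v k → Walk u v (suc k)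

  DistLe : Fin n → Fin n → ℕ → Set
  DistLe u v k = ∃[ j ] (j ≤ k × Walk u v j)

  Dist : Fin n → Fin n → ℕ → Set
  Dist u v d = DistLe u v d × (∀ k → DistLe u v k → d ≤ k)

  Connected : Set
  Connected = ∀ u v → ∃[ k ] Walk u v k

  Ecc : Fin n → ℕ → Set
  Ecc v e = (∀ u → DistLe v u e) × (∃[ u ] Dist v u e)

  IsBroadcast : (Fin n → ℕ) → Set
  IsBroadcast f = ∀ v → ∃[ e ] (Ecc v e × f v ≤ e)

  Hears : (Fin n → ℕ) → Fin n → Fin n → Set
  Hears f u v = (0 < f v) × DistLe u v (f v)

  PrivHears : (Fin n → ℕ) → Fin n → Fin n → Set
  PrivHears f u v = Hears f u v × (∀ w → Hears f u w → w ≡ v)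

  Boundary : (Fin n → ℕ) → Fin n → Fin n → Set
  Boundary f u v = Hears f u v × Dist u v (f v)

  BnIndependent : (Fin n → ℕ) → Set
  BnIndependent f = IsBroadcast f ×
    (∀ v → 0 < f v → ∀ u → Hears f u v → ¬ Boundary f u v → PrivHears f u v)

  cost : (Fin n → ℕ) → ℕ
  cost f = sum (tabulate f)

  IsBnIndependenceNumber : ℕ → Set
  IsBnIndependenceNumber m =
    (∃[ f ] (BnIndependent f × cost f ≡ m)) ×
    (∀ f → BnIndependent f → cost f ≤ m)

  Independent : Subset n → Set
  Independent S = ∀ u v → u ∈ S → v ∈ S → ¬ Adj G u v

  IsIndependenceNumber : ℕ → Set
  IsIndependenceNumber m =
    (∃[ S ] (Independent S × ∣ S ∣ ≡ m)) ×
    (∀ S → Independent S → ∣ S ∣ ≤ m)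

-- For every broadcasting vertex v fix a
-- geodesic of length at least f(v) starting at v, and mark its vertices at the even
-- distances 0, 2, …, 2(⌈f(v)/2⌉ − 1) from v. These lie strictly inside the ball of v,
-- so they hear only v; hence marks of different vertices are distinct and
-- non-adjacent, and two marks of the same v are non-adjacent because they are at least
-- two apart along a geodesic. The marks form an independent set of size
-- Σ ⌈f(v)/2⌉ ≥ σ(f)/2. Equality forces every f(v) to be even, and then the far end of
-- the geodesic of a broadcasting vertex can be added to the marks (if f is zero, any
-- single vertex does).
module Submission where

open import Data.Nat using (ℕ; zero; suc; _+_; _*_; _∸_; _≤_; _<_; z≤n; s≤s; ⌈_/2⌉; _<?_)
open import Data.Nat.Properties hiding (suc-injective)
open import Data.Nat.ListAction using (sum)
open import Data.Fin using (Fin; zero; suc; toℕ)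
open import Data.Fin.Properties using (toℕ-injective; toℕ<n; any?; suc-injective)
open import Data.Fin.Subset using (Subset; _∈_; _∉_; ∣_∣; ⁅_⁆; _∪_; inside; outside) renaming (⊥ to ∅)
open import Data.Fin.Subset.Properties using (∉⊥; x∈⁅y⁆⇒x≡y; ∣⁅x⁆∣≡1; x∈p∪q⁻; ∣⊥∣≡0)
open import Data.Vec using ([]; _∷_)
open import Data.Vec.Base using (here; there)
open import Data.List using (tabulate)
open import Data.Product using (Σ-syntax; _×_; _,_; proj₁; proj₂; ∃-syntax)
open import Data.Sum using (inj₁; inj₂)
open import Relation.Nullary using (¬_; yes; no; contradiction)
open import Relation.Binary.PropositionalEquality
open import Defs hiding (sym)

∑ : ∀ {m} → (Fin m → ℕ) → ℕ
∑ g = sum (tabulate g)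

∑-cong : ∀ {m} {g h : Fin m → ℕ} → (∀ i → g i ≡ h i) → ∑ g ≡ ∑ h
∑-cong {zero}  eq = refl
∑-cong {suc m} eq = cong₂ _+_ (eq zero) (∑-cong (λ i → eq (suc i)))

∑-mono-≤ : ∀ {m} {g h : Fin m → ℕ} → (∀ i → g i ≤ h i) → ∑ g ≤ ∑ h
∑-mono-≤ {zero}  le = z≤n
∑-mono-≤ {suc m} le = +-mono-≤ (le zero) (∑-mono-≤ (λ i → le (suc i)))

∑-mono-< : ∀ {m} {g h : Fin m → ℕ} → (∀ i → g i ≤ h i) → ∃[ i ] g i < h i → ∑ g < ∑ h
∑-mono-< le (zero  , lt) = +-mono-<-≤ lt (∑-mono-≤ (λ i → le (suc i)))
∑-mono-< le (suc i , lt) = +-mono-≤-< (le zero) (∑-mono-< (λ i → le (suc i)) (i , lt))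

∑-*ˡ : ∀ {m} c (g : Fin m → ℕ) → ∑ (λ i → c * g i) ≡ c * ∑ g
∑-*ˡ {zero}  c g = sym (*-zeroʳ c)
∑-*ˡ {suc m} c g = trans (cong (c * g zero +_) (∑-*ˡ c (λ i → g (suc i))))
                         (sym (*-distribˡ-+ c (g zero) _))

∑-const : ∀ {m} c → ∑ {m} (λ _ → c) ≡ m * c
∑-const {zero}  c = refl
∑-const {suc m} c = cong (c +_) (∑-const {m} c)

i<j⇒1+2i<2j : ∀ {i j} → i < j → suc (2 * i) < 2 * j
i<j⇒1+2i<2j {i} {j} i<j = subst (_≤ 2 * j) (*-suc 2 i) (*-monoʳ-≤ 2 i<j)

2j≤1+2i⇒j≤i : ∀ {i j} → 2 * j ≤ suc (2 * i) → j ≤ i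
2j≤1+2i⇒j≤i le = ≮⇒≥ (λ i<j → <⇒≱ (i<j⇒1+2i<2j i<j) le)

n≤2⌈n/2⌉ : ∀ n → n ≤ 2 * ⌈ n /2⌉
n≤2⌈n/2⌉ zero          = z≤n
n≤2⌈n/2⌉ (suc zero)    = s≤s z≤n
n≤2⌈n/2⌉ (suc (suc n)) = subst (suc (suc n) ≤_) (sym (*-suc 2 ⌈ n /2⌉)) (s≤s (s≤s (n≤2⌈n/2⌉ n)))

2⌈n/2⌉≤1+n : ∀ n → 2 * ⌈ n /2⌉ ≤ suc n
2⌈n/2⌉≤1+n zero          = z≤n
2⌈n/2⌉≤1+n (suc zero)    = s≤s (s≤s z≤n)
2⌈n/2⌉≤1+n (suc (suc n)) = subst (_≤ suc (suc (suc n))) (sym (*-suc 2 ⌈ n /2⌉)) (s≤s (s≤s (2⌈n/2⌉≤1+n n)))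

i<⌈n/2⌉⇒2i<n : ∀ {i n} → i < ⌈ n /2⌉ → 2 * i < n
i<⌈n/2⌉⇒2i<n {n = n} lt = ≤-pred (≤-trans (i<j⇒1+2i<2j lt) (2⌈n/2⌉≤1+n n))

∣p∪q∣≡∣p∣+∣q∣ : ∀ {n} (p q : Subset n) → (∀ {x} → x ∈ p → x ∉ q) → ∣ p ∪ q ∣ ≡ ∣ p ∣ + ∣ q ∣
∣p∪q∣≡∣p∣+∣q∣ []            []            _ = refl
∣p∪q∣≡∣p∣+∣q∣ (outside ∷ p) (outside ∷ q) d = ∣p∪q∣≡∣p∣+∣q∣ p q (λ x∈p x∈q → d (there x∈p) (there x∈q))
∣p∪q∣≡∣p∣+∣q∣ (outside ∷ p) (inside ∷ q)  d =
  trans (cong suc (∣p∪q∣≡∣p∣+∣q∣ p q (λ x∈p x∈q → d (there x∈p) (there x∈q)))) (sym (+-suc ∣ p ∣ ∣ q ∣))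
∣p∪q∣≡∣p∣+∣q∣ (inside ∷ p)  (outside ∷ q) d = cong suc (∣p∪q∣≡∣p∣+∣q∣ p q (λ x∈p x∈q → d (there x∈p) (there x∈q)))
∣p∪q∣≡∣p∣+∣q∣ (inside ∷ p)  (inside ∷ q)  d = contradiction here (d here)

⋃ᶠ : ∀ {m n} → (Fin m → Subset n) → Subset n
⋃ᶠ {zero}  F = ∅
⋃ᶠ {suc m} F = F zero ∪ ⋃ᶠ (λ i → F (suc i))

x∈⋃ᶠ⁻ : ∀ {m n} (F : Fin m → Subset n) {x} → x ∈ ⋃ᶠ F → ∃[ i ] x ∈ F i
x∈⋃ᶠ⁻ {zero}  F x∈∅ = contradiction x∈∅ ∉⊥
x∈⋃ᶠ⁻ {suc m} F x∈⋃ with x∈p∪q⁻ (F zero) (⋃ᶠ (λ i → F (suc i))) x∈⋃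
... | inj₁ x∈F₀ = zero , x∈F₀
... | inj₂ x∈⋃′ with x∈⋃ᶠ⁻ (λ i → F (suc i)) x∈⋃′
...   | i , x∈Fᵢ = suc i , x∈Fᵢ

∣⋃ᶠ∣≡∑∣_∣ : ∀ {m n} (F : Fin m → Subset n) → (∀ {i j x} → x ∈ F i → x ∈ F j → i ≡ j) →
            ∣ ⋃ᶠ F ∣ ≡ ∑ (λ i → ∣ F i ∣)
∣⋃ᶠ∣≡∑∣_∣ {zero}  {n} F _        = ∣⊥∣≡0 n
∣⋃ᶠ∣≡∑∣_∣ {suc m}     F disjoint =
  trans (∣p∪q∣≡∣p∣+∣q∣ (F zero) (⋃ᶠ F′) F₀-disjoint)
        (cong (∣ F zero ∣ +_) (∣⋃ᶠ∣≡∑∣_∣ F′ (λ x∈Fᵢ x∈Fⱼ → suc-injective (disjoint x∈Fᵢ x∈Fⱼ))))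
  where
  F′ : Fin m → Subset _
  F′ i = F (suc i)
  F₀-disjoint : ∀ {x} → x ∈ F zero → x ∉ ⋃ᶠ F′
  F₀-disjoint x∈F₀ x∈⋃ with x∈⋃ᶠ⁻ F′ x∈⋃
  ... | i , x∈Fᵢ with () ← disjoint x∈F₀ x∈Fᵢ

module _ {n} (G : Graph n) where

  ⁅⁆-independent : ∀ x → Independent G ⁅ x ⁆
  ⁅⁆-independent x u v u∈ v∈ adj
    rewrite x∈⁅y⁆⇒x≡y x u∈ | x∈⁅y⁆⇒x≡y x v∈ = Graph.irrefl G adj

  ⁅⁆∪-independent : ∀ {S} x → Independent G S → (∀ y → y ∈ S → ¬ Adj G x y) →
                    Independent G (⁅ x ⁆ ∪ S)
  ⁅⁆∪-independent {S} x S-indep x≁S u v u∈ v∈ adj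
    with x∈p∪q⁻ ⁅ x ⁆ S u∈ | x∈p∪q⁻ ⁅ x ⁆ S v∈
  ... | inj₁ u∈x | inj₁ v∈x = ⁅⁆-independent x u v u∈x v∈x adj
  ... | inj₁ u∈x | inj₂ v∈S rewrite x∈⁅y⁆⇒x≡y x u∈x = x≁S v v∈S adj
  ... | inj₂ u∈S | inj₁ v∈x rewrite x∈⁅y⁆⇒x≡y x v∈x = x≁S u u∈S (Graph.sym G adj)
  ... | inj₂ u∈S | inj₂ v∈S = S-indep u v u∈S v∈S adj

  snoc : ∀ {u v w k} → Walk G u v k → Adj G v w → Walk G u w (suc k)
  snoc here       adj = step adj here
  snoc (step e p) adj = step e (snoc p adj)

  reverse : ∀ {u v k} → Walk G u v k → Walk G v u k
  reverse here       = here
  reverse (step e p) = snoc (reverse p) (Graph.sym G e)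

  _++_ : ∀ {u v w i j} → Walk G u v i → Walk G v w j → Walk G u w (i + j)
  here     ++ q = q
  step e p ++ q = step e (p ++ q)

  -- Indices past the end of the walk give its last vertex.
  vertexAt : ∀ {u v k} → Walk G u v k → ℕ → Fin n
  vertexAt {u} p          zero    = u
  vertexAt {u} here       (suc i) = u
  vertexAt     (step _ p) (suc i) = vertexAt p i

  take : ∀ {u v k} (p : Walk G u v k) i → i ≤ k → Walk G u (vertexAt p i) i
  take p          zero    _         = here
  take (step e p) (suc i) (s≤s i≤k) = step e (take p i i≤k)

  drop : ∀ {u v k} (p : Walk G u v k) i → i ≤ k → Walk G (vertexAt p i) v (k ∸ i)
  drop p          zero    _         = p
  drop (step e p) (suc i) (s≤s i≤k) = drop p i i≤k

  record Geodesic (u : Fin n) : Set where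
    field
      end      : Fin n
      length   : ℕ
      walk     : Walk G u end length
      shortest : ∀ {m} → Walk G u end m → length ≤ m

    at : ℕ → Fin n
    at = vertexAt walk

    walkTo : ∀ i → i ≤ length → Walk G u (at i) i
    walkTo = take walk

    distance-at : ∀ {i m} → i ≤ length → Walk G u (at i) m → i ≤ m
    distance-at {i} {m} i≤L p = +-cancelʳ-≤ (length ∸ i) i m (begin
      i + (length ∸ i) ≡⟨ m+[n∸m]≡n i≤L ⟩
      length           ≤⟨ shortest (p ++ drop walk i i≤L) ⟩
      m + (length ∸ i) ∎)
      where open ≤-Reasoning

    at-injective : ∀ {i j} → i ≤ length → j ≤ length → at i ≡ at j → i ≡ j
    at-injective {i} {j} i≤L j≤L eq = ≤-antisym
      (distance-at i≤L (subst (λ x → Walk G u x j) (sym eq) (walkTo j j≤L)))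
      (distance-at j≤L (subst (λ x → Walk G u x i) eq (walkTo i i≤L)))

  broadcast-geodesic : ∀ {f} → IsBroadcast G f → ∀ u → Σ[ g ∈ Geodesic u ] f u ≤ Geodesic.length g
  broadcast-geodesic isBroadcast u
    with isBroadcast u
  ... | _ , (_ , end , (j , j≤e , p) , minimal) , fu≤e = record
    { end      = end
    ; length   = j
    ; walk     = p
    ; shortest = λ {m} q → ≤-trans j≤e (minimal m (m , ≤-refl , q))
    } , ≤-trans fu≤e (minimal j (j , ≤-refl , p))

module Marks {n} (G : Graph n) {f : Fin n → ℕ} (bn : BnIndependent G f) where

  interior-private : ∀ {v x i} → i < f v → Walk G v x i → ∀ {w} → Hears G f x w → w ≡ v
  interior-private {v} {x} {i} i<fv p {w} x-hears-w =
    proj₂ (proj₂ bn v 0<fv x x-hears-v not-boundary) w x-hears-w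
    where
    0<fv : 0 < f v
    0<fv = ≤-<-trans z≤n i<fv
    x-hears-v : Hears G f x v
    x-hears-v = 0<fv , i , <⇒≤ i<fv , reverse G p
    not-boundary : ¬ Boundary G f x v
    not-boundary (_ , _ , minimal) = <⇒≱ i<fv (minimal i (i , ≤-refl , reverse G p))

  geodesic : ∀ v → Geodesic G v
  geodesic v = proj₁ (broadcast-geodesic G (proj₁ bn) v)

  f≤length : ∀ v → f v ≤ Geodesic.length (geodesic v)
  f≤length v = proj₂ (broadcast-geodesic G (proj₁ bn) v)

  ray : Fin n → ℕ → Fin n
  ray v = Geodesic.at (geodesic v)

  ray-walk : ∀ {v i} → i ≤ f v → Walk G v (ray v i) i
  ray-walk {v} {i} i≤fv = Geodesic.walkTo (geodesic v) i (≤-trans i≤fv (f≤length v))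

  ray-distance : ∀ {v i m} → i ≤ f v → Walk G v (ray v i) m → i ≤ m
  ray-distance {v} i≤fv = Geodesic.distance-at (geodesic v) (≤-trans i≤fv (f≤length v))

  ray-injective : ∀ {v i j} → i ≤ f v → j ≤ f v → ray v i ≡ ray v j → i ≡ j
  ray-injective {v} i≤fv j≤fv =
    Geodesic.at-injective (geodesic v) (≤-trans i≤fv (f≤length v)) (≤-trans j≤fv (f≤length v))

  half : Fin n → ℕ
  half v = ⌈ f v /2⌉

  mark : Fin n → ℕ → Fin n
  mark v i = ray v (2 * i)

  2i<f : ∀ {v i} → i < half v → 2 * i < f v
  2i<f = i<⌈n/2⌉⇒2i<n

  mark-walk : ∀ {v i} → i < half v → Walk G v (mark v i) (2 * i)
  mark-walk i<half = ray-walk (<⇒≤ (2i<f i<half))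

  mark-distance : ∀ {v i m} → i < half v → Walk G v (mark v i) m → 2 * i ≤ m
  mark-distance i<half = ray-distance (<⇒≤ (2i<f i<half))

  mark-injective : ∀ {v i j} → i < half v → j < half v → mark v i ≡ mark v j → i ≡ j
  mark-injective {i = i} {j} i<half j<half eq =
    *-cancelˡ-≡ i j 2 (ray-injective (<⇒≤ (2i<f i<half)) (<⇒≤ (2i<f j<half)) eq)

  mark-hears : ∀ {v i} → i < half v → Hears G f (mark v i) v
  mark-hears i<half = ≤-<-trans z≤n (2i<f i<half) , _ , <⇒≤ (2i<f i<half) , reverse G (mark-walk i<half)

  mark-private : ∀ {v i} → i < half v → ∀ {w} → Hears G f (mark v i) w → w ≡ v
  mark-private i<half = interior-private (2i<f i<half) (mark-walk i<half)

  neighbour-hears : ∀ {x w j} → j < half w → Adj G x (mark w j) → Hears G f x w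
  neighbour-hears j<half adj =
    ≤-<-trans z≤n (2i<f j<half) , _ , 2i<f j<half , step adj (reverse G (mark-walk j<half))

  -- Two marks of the same vertex are joined by an edge only if their distances to it
  -- differ by at most one, which for even distances means they coincide.
  marks-nonadjacent : ∀ {v i w j} → i < half v → j < half w → ¬ Adj G (mark v i) (mark w j)
  marks-nonadjacent {v} {i} {w} {j} i<half j<half adj
    with mark-private i<half (neighbour-hears j<half adj)
  ... | refl = Graph.irrefl G (subst (λ k → Adj G (mark v i) (mark v k)) (sym i≡j) adj)
    where
    i≡j : i ≡ j
    i≡j = ≤-antisym (2j≤1+2i⇒j≤i (mark-distance i<half (snoc G (mark-walk j<half) (Graph.sym G adj))))
                    (2j≤1+2i⇒j≤i (mark-distance j<half (snoc G (mark-walk i<half) adj)))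

  marksOf : Fin n → Subset n
  marksOf v = ⋃ᶠ (λ (i : Fin (half v)) → ⁅ mark v (toℕ i) ⁆)

  marked : Subset n
  marked = ⋃ᶠ marksOf

  x∈marksOf⁻ : ∀ {v x} → x ∈ marksOf v → ∃[ i ] (i < half v × x ≡ mark v i)
  x∈marksOf⁻ {v} x∈ with x∈⋃ᶠ⁻ (λ (i : Fin (half v)) → ⁅ mark v (toℕ i) ⁆) x∈
  ... | i , x∈⁅mark⁆ = toℕ i , toℕ<n i , x∈⁅y⁆⇒x≡y _ x∈⁅mark⁆

  x∈marked⁻ : ∀ {x} → x ∈ marked → ∃[ v ] ∃[ i ] (i < half v × x ≡ mark v i)
  x∈marked⁻ x∈ with x∈⋃ᶠ⁻ marksOf x∈
  ... | v , x∈marksOf = v , x∈marksOf⁻ x∈marksOf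

  ∣marksOf∣ : ∀ v → ∣ marksOf v ∣ ≡ half v
  ∣marksOf∣ v = begin
    ∣ marksOf v ∣                      ≡⟨ ∣⋃ᶠ∣≡∑∣_∣ (λ i → ⁅ mark v (toℕ i) ⁆) disjoint ⟩
    ∑ {half v} (λ i → ∣ ⁅ mark v (toℕ i) ⁆ ∣)  ≡⟨ ∑-cong {half v} (λ i → ∣⁅x⁆∣≡1 (mark v (toℕ i))) ⟩
    ∑ {half v} (λ _ → 1)               ≡⟨ ∑-const {half v} 1 ⟩
    half v * 1                         ≡⟨ *-identityʳ (half v) ⟩
    half v                             ∎
    where
    open ≡-Reasoning
    disjoint : ∀ {i j : Fin (half v)} {x} → x ∈ ⁅ mark v (toℕ i) ⁆ → x ∈ ⁅ mark v (toℕ j) ⁆ → i ≡ j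
    disjoint {i} {j} x∈i x∈j = toℕ-injective (mark-injective (toℕ<n i) (toℕ<n j)
      (trans (sym (x∈⁅y⁆⇒x≡y _ x∈i)) (x∈⁅y⁆⇒x≡y _ x∈j)))

  ∣marked∣ : ∣ marked ∣ ≡ ∑ half
  ∣marked∣ = trans (∣⋃ᶠ∣≡∑∣_∣ marksOf disjoint) (∑-cong ∣marksOf∣)
    where
    disjoint : ∀ {v w x} → x ∈ marksOf v → x ∈ marksOf w → v ≡ w
    disjoint {w = w} x∈v x∈w with x∈marksOf⁻ x∈v | x∈marksOf⁻ x∈w
    ... | i , i<half , refl | j , j<half , eq =
      sym (mark-private i<half (subst (λ x → Hears G f x w) (sym eq) (mark-hears j<half)))

  marked-independent : Independent G marked
  marked-independent x y x∈ y∈ with x∈marked⁻ x∈ | x∈marked⁻ y∈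
  ... | _ , _ , i<half , refl | _ , _ , j<half , refl = marks-nonadjacent i<half j<half

  cost-marked : ∑ (λ v → 2 * half v) ≡ 2 * ∣ marked ∣
  cost-marked = trans (∑-*ˡ 2 half) (cong (2 *_) (sym ∣marked∣))

  module Apex (even : ∀ v → f v ≡ 2 * half v) {v₀} (0<fv₀ : 0 < f v₀) where

    apex : Fin n
    apex = ray v₀ (f v₀)

    apex-hears : Hears G f apex v₀
    apex-hears = 0<fv₀ , f v₀ , ≤-refl , reverse G (ray-walk ≤-refl)

    1+2i<f : ∀ {v i} → i < half v → suc (2 * i) < f v
    1+2i<f {v} {i} i<half = subst (suc (2 * i) <_) (sym (even v)) (i<j⇒1+2i<2j i<half)

    apex∉marked : apex ∉ marked
    apex∉marked apex∈ with x∈marked⁻ apex∈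
    ... | w , j , j<half , eq with mark-private j<half (subst (λ x → Hears G f x v₀) eq apex-hears)
    ... | refl = <⇒≱ (2i<f j<half) (ray-distance ≤-refl (subst (λ x → Walk G v₀ x _) (sym eq) (mark-walk j<half)))

    -- The apex is adjacent to no mark since an even f forces its neighbours on the ray
    -- to be strictly inside the ball, where only v₀ is heard.
    apex-nonadjacent : ∀ y → y ∈ marked → ¬ Adj G apex y
    apex-nonadjacent y y∈ adj with x∈marked⁻ y∈
    ... | w , j , j<half , refl
      with interior-private (1+2i<f j<half) (snoc G (mark-walk j<half) (Graph.sym G adj)) apex-hears
    ... | refl = <⇒≱ (1+2i<f j<half) (ray-distance ≤-refl (snoc G (mark-walk j<half) (Graph.sym G adj)))

    ∣apex∪marked∣ : ∣ ⁅ apex ⁆ ∪ marked ∣ ≡ suc ∣ marked ∣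
    ∣apex∪marked∣ = trans
      (∣p∪q∣≡∣p∣+∣q∣ ⁅ apex ⁆ marked (λ x∈ → subst (_∉ marked) (sym (x∈⁅y⁆⇒x≡y apex x∈)) apex∉marked))
      (cong (_+ ∣ marked ∣) (∣⁅x⁆∣≡1 apex))

  large-independent-set : Fin n → ∃[ S ] (Independent G S × cost G f < 2 * ∣ S ∣)
  large-independent-set u with any? (λ v → f v <? 2 * half v)
  ... | yes odd = marked , marked-independent , (begin-strict
    ∑ f                      <⟨ ∑-mono-< (λ v → n≤2⌈n/2⌉ (f v)) odd ⟩
    ∑ (λ v → 2 * half v)     ≡⟨ cost-marked ⟩
    2 * ∣ marked ∣           ∎)
    where open ≤-Reasoning
  ... | no ¬odd with any? (λ v → 0 <? f v)
  ...   | yes (v₀ , 0<fv₀) =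
    ⁅ apex ⁆ ∪ marked , ⁅⁆∪-independent G apex marked-independent apex-nonadjacent , (begin-strict
      ∑ f                          ≡⟨ ∑-cong even ⟩
      ∑ (λ v → 2 * half v)         ≡⟨ cost-marked ⟩
      2 * ∣ marked ∣               <⟨ *-monoʳ-< 2 (n<1+n ∣ marked ∣) ⟩
      2 * suc ∣ marked ∣           ≡⟨ cong (2 *_) (sym ∣apex∪marked∣) ⟩
      2 * ∣ ⁅ apex ⁆ ∪ marked ∣    ∎)
    where
    open ≤-Reasoning
    even : ∀ v → f v ≡ 2 * half v
    even v = ≤-antisym (n≤2⌈n/2⌉ (f v)) (≮⇒≥ (λ lt → ¬odd (v , lt)))
    open Apex even 0<fv₀
  ...   | no ¬positive = ⁅ u ⁆ , ⁅⁆-independent G u , (begin-strict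
      ∑ f                  ≡⟨ ∑-cong silent ⟩
      ∑ {n} (λ _ → 0)      ≡⟨ ∑-const {n} 0 ⟩
      n * 0                ≡⟨ *-zeroʳ n ⟩
      0                    <⟨ s≤s z≤n ⟩
      2 * 1                ≡⟨ cong (2 *_) (sym (∣⁅x⁆∣≡1 u)) ⟩
      2 * ∣ ⁅ u ⁆ ∣        ∎)
    where
    open ≤-Reasoning
    silent : ∀ v → f v ≡ 0
    silent v = n≤0⇒n≡0 (≮⇒≥ (λ lt → ¬positive (v , lt)))

theorem3p1 : ∀ (n : ℕ) (G : Graph n) → 2 ≤ n → Connected G →
    ∀ (a b : ℕ) → IsBnIndependenceNumber G a → IsIndependenceNumber G b →
    a < 2 * b
theorem3p1 (suc n) G _ _ _ b ((f , bn , refl) , _) (_ , maximum)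
  with Marks.large-independent-set G bn zero
... | S , S-independent , cost<2∣S∣ = <-≤-trans cost<2∣S∣ (*-monoʳ-≤ 2 (maximum S S-independent))
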